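{- Let $\mathfrak{d}_{n,k}$ (resp. $\mathfrak{d}^e_{n,k}$, $\mathfrak{d}^o_{n,k}$) be the number of parity alternating derangements (resp. even, odd parity alternating derangements) of $[n]$ having exactly $k$ excedances. Then for all $n,k$, \[ \mathfrak{d}_{n,k}=\mathfrak{d}_{n,n-k},\qquad \mathfrak{d}^e_{n,k}=\mathfrak{d}^e_{n,n-k},\qquad \mathfrak{d}^o_{n,k}=\mathfrak{d}^o_{n,n-k}. \]
   Context: A permutation $\sigma$ of $[n]=\{1,\dots,n\}$, in one-line notation, is a PAP if $\sigma(i)\equiv i\pmod 2$ for all $i$ (entries alternate in parity, first entry odd); a parity alternating derangement (PAD) is a PAP with $\sigma(i)\ne i$ for all $i$. An excedance of $\sigma$ is an index $i\in[n]$ with $\sigma(i)>i$. Parity: sign $(-1)^{n-c}$, $c$ the number of cycles. -}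

module Defs where

open import Data.Nat using (ℕ; zero; suc; _∸_; _<ᵇ_; _≤ᵇ_; _≡ᵇ_; _%_)
open import Data.Bool using (Bool; true; false; _∧_; not)
open import Data.Fin using (Fin; toℕ)
open import Data.Vec using (Vec; []; _∷_; lookup)
open import Data.List using (List; []; _∷_; map; concatMap; filter; length; allFin; upTo)
open import Data.Bool.ListAction using (all; any)
open import Relation.Nullary.Decidable using (_because_)
open import Relation.Unary using (Decidable)
open import Data.Bool.Properties using (T?)
open import Function using (_∘_)

-- A map [n] → [n] in one-line notation: entry i (0-based, Fin n) is σ(i).
-- Position i ∈ Fin n stands for i+1 ∈ [n]; value toℕ (σ i) + 1 likewise.
-- All notions below (parity agreement, excedance) are invariant under this shift.

allVecs : (n m : ℕ) → List (Vec (Fin n) m)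
allVecs n zero    = [] ∷ []
allVecs n (suc m) = concatMap (λ x → map (x ∷_) (allVecs n m)) (allFin n)

-- σ is a permutation: every value is attained (surjective endomap of a finite set)
isPermᵇ : ∀ {n} → Vec (Fin n) n → Bool
isPermᵇ {n} σ = all (λ v → any (λ i → toℕ (lookup σ i) ≡ᵇ toℕ v) (allFin n)) (allFin n)

parity : ℕ → ℕ
parity m = m % 2

isPAPᵇ : ∀ {n} → Vec (Fin n) n → Bool
isPAPᵇ {n} σ = all (λ i → parity (toℕ (lookup σ i)) ≡ᵇ parity (toℕ i)) (allFin n)

isFixedPointFreeᵇ : ∀ {n} → Vec (Fin n) n → Bool
isFixedPointFreeᵇ {n} σ = all (λ i → not (toℕ (lookup σ i) ≡ᵇ toℕ i)) (allFin n)

isPADᵇ : ∀ {n} → Vec (Fin n) n → Bool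
isPADᵇ σ = isPermᵇ σ ∧ isPAPᵇ σ ∧ isFixedPointFreeᵇ σ

exc : ∀ {n} → Vec (Fin n) n → ℕ
exc {n} σ = length (filter (λ i → T? (toℕ i <ᵇ toℕ (lookup σ i))) (allFin n))

iter : ∀ {n} → ℕ → Vec (Fin n) n → Fin n → Fin n
iter zero    σ i = i
iter (suc j) σ i = lookup σ (iter j σ i)

isCycleMinᵇ : ∀ {n} → Vec (Fin n) n → Fin n → Bool
isCycleMinᵇ {n} σ i = all (λ j → toℕ i ≤ᵇ toℕ (iter j σ i)) (upTo n)

-- number of cycles = number of cycle minima
cycles : ∀ {n} → Vec (Fin n) n → ℕ
cycles {n} σ = length (filter (λ i → T? (isCycleMinᵇ σ i)) (allFin n))

-- σ is even iff (-1)^(n - c) = 1, i.e. n - c is even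
isEvenᵇ : ∀ {n} → Vec (Fin n) n → Bool
isEvenᵇ {n} σ = parity (n ∸ cycles σ) ≡ᵇ 0

isOddᵇ : ∀ {n} → Vec (Fin n) n → Bool
isOddᵇ σ = not (isEvenᵇ σ)


allPADs : (n : ℕ) → List (Vec (Fin n) n)
allPADs n = filter (λ σ → T? (isPADᵇ σ)) (allVecs n n)

𝔡 : ℕ → ℕ → ℕ
𝔡 n k = length (filter (λ σ → T? (exc σ ≡ᵇ k)) (allPADs n))

𝔡ᵉ : ℕ → ℕ → ℕ
𝔡ᵉ n k = length (filter (λ σ → T? ((exc σ ≡ᵇ k) ∧ isEvenᵇ σ)) (allPADs n))

𝔡ᵒ : ℕ → ℕ → ℕ
𝔡ᵒ n k = length (filter (λ σ → T? ((exc σ ≡ᵇ k) ∧ isOddᵇ σ)) (allPADs n))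

{-# OPTIONS --safe #-}
-- Inversion σ ↦ σ⁻¹ is an involution of the set of parity alternating
-- derangements of [n].  It preserves parity alternation (σ(i) ≡ i mod 2 gives
-- σ⁻¹(j) ≡ j mod 2 for j = σ(i)), fixed-point freeness and the cycles, hence the
-- sign.  The excedances of σ⁻¹ are the values σ(i) with σ(i) < i, so for a
-- derangement exc σ⁻¹ = n − exc σ: inversion carries the PADs with k excedances
-- bijectively onto those with n − k, separately among even and odd ones.
module Submission where

open import Defs
open import Data.Bool using (Bool; true; false; _∧_; not; T)
open import Data.Bool.ListAction using (all)
open import Data.Bool.Properties using (T?; T-∧)
open import Data.Empty using (⊥-elim)
open import Data.Fin using (Fin; toℕ)
open import Data.Fin.Properties using (toℕ-injective; toℕ<n; pigeonhole; any?; _≟_)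
open import Data.List
  using (List; []; _∷_; map; filter; length; allFin; upTo; concatMap; cartesianProductWith; _++_)
open import Data.List.Membership.Propositional using (_∈_; lose)
open import Data.List.Membership.Propositional.Properties
  using (∈-map⁺; ∈-map⁻; ∈-allFin; ∈-upTo⁺; ∈-upTo⁻; ∈-filter⁺; ∈-filter⁻; ∈-cartesianProductWith⁺)
open import Data.List.Membership.Propositional.Properties.WithK using (unique∧set⇒bag)
open import Data.List.Properties using (length-tabulate)
open import Data.List.Relation.Binary.BagAndSetEquality using (∼bag⇒↭)
open import Data.List.Relation.Binary.Permutation.Propositional using (_↭_; ↭-sym)
open import Data.List.Relation.Binary.Permutation.Propositional.Properties using (↭-length; filter-↭)
open import Data.List.Relation.Unary.All as All using (All; [])
open import Data.List.Relation.Unary.All.Properties using (all⁺; all⁻) renaming (map⁺ to All-map⁺)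
open import Data.List.Relation.Unary.AllPairs using ([]; _∷_)
open import Data.List.Relation.Unary.Any using (here; there; satisfied)
open import Data.List.Relation.Unary.Any.Properties using (any⁺; any⁻)
open import Data.List.Relation.Unary.Unique.Propositional using (Unique)
open import Data.List.Relation.Unary.Unique.Propositional.Properties
  using (allFin⁺; cartesianProductWith⁺) renaming (filter⁺ to Unique-filter⁺)
open import Data.Nat using (ℕ; zero; suc; _+_; _∸_; _≤_; _<_; _<ᵇ_; _≡ᵇ_; z≤n; s≤s⁻¹)
import Data.Nat.Properties as ℕ
open import Data.Product using (_×_; ∃; _,_; proj₁; proj₂; map₂)
open import Data.Unit using (tt)
open import Data.Vec using (Vec; []; _∷_; lookup; tabulate)
open import Data.Vec.Properties using (∷-injective; lookup∘tabulate; tabulate∘lookup; tabulate-cong)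
open import Function using (_∘_; id)
open import Function.Bundles using (_⇔_; mk⇔; Equivalence)
open import Function.Definitions using (Injective)
open import Relation.Binary.PropositionalEquality
  using (_≡_; _≢_; refl; sym; trans; cong; cong₂; subst; module ≡-Reasoning)
open import Relation.Nullary using (Dec; ¬_; yes; no)

open Equivalence using (to; from)
open ≡-Reasoning

T-injective : ∀ {a b} → (T a ⇔ T b) → a ≡ b
T-injective {false} {false} _   = refl
T-injective {false} {true}  a⇔b = ⊥-elim (from a⇔b tt)
T-injective {true}  {false} a⇔b = ⊥-elim (to a⇔b tt)
T-injective {true}  {true}  _   = refl

T-not : ∀ {b} → T (not b) ⇔ (¬ T b)
T-not {false} = mk⇔ (λ _ ()) (λ _ → tt)
T-not {true}  = mk⇔ (λ ()) (λ ¬tt → ¬tt tt)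

T-≡ᵇ : ∀ {m n} → T (m ≡ᵇ n) ⇔ (m ≡ n)
T-≡ᵇ {m} {n} = mk⇔ (ℕ.≡ᵇ⇒≡ m n) (ℕ.≡⇒≡ᵇ m n)

T-toℕ-≡ᵇ : ∀ {n} {i j : Fin n} → T (toℕ i ≡ᵇ toℕ j) ⇔ (i ≡ j)
T-toℕ-≡ᵇ = mk⇔ (toℕ-injective ∘ to T-≡ᵇ) (from T-≡ᵇ ∘ cong toℕ)

T-all-allFin : ∀ {n} (p : Fin n → Bool) → T (all p (allFin n)) ⇔ (∀ i → T (p i))
T-all-allFin p = mk⇔
  (λ h i → All.lookup (all⁺ p _ h) (∈-allFin i))
  (λ h → all⁻ p (All.tabulate {xs = allFin _} (λ {i} _ → h i)))

T-all-upTo : ∀ {n} (p : ℕ → Bool) → T (all p (upTo n)) ⇔ (∀ j → j < n → T (p j))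
T-all-upTo p = mk⇔
  (λ h j j<n → All.lookup (all⁺ p _ h) (∈-upTo⁺ j<n))
  (λ h → all⁻ p (All.tabulate {xs = upTo _} (λ j∈ → h _ (∈-upTo⁻ j∈))))

<ᵇ≡not-flip : ∀ {m n} → m ≢ n → (m <ᵇ n) ≡ not (n <ᵇ m)
<ᵇ≡not-flip {m} {n} m≢n = T-injective (mk⇔
  (λ m<ᵇn → from T-not (λ n<ᵇm → ℕ.<-asym (ℕ.<ᵇ⇒< m n m<ᵇn) (ℕ.<ᵇ⇒< n m n<ᵇm)))
  (λ ¬n<ᵇm → ℕ.<⇒<ᵇ (ℕ.≤∧≢⇒< (ℕ.≮⇒≥ (to T-not ¬n<ᵇm ∘ ℕ.<⇒<ᵇ)) m≢n)))

≡ᵇ-complement : ∀ a b {n k} → a + b ≡ n → k ≤ n → (a ≡ᵇ k) ≡ (b ≡ᵇ n ∸ k)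
≡ᵇ-complement a b {n} {k} a+b≡n k≤n = T-injective (mk⇔
  (λ a≡ᵇk → from T-≡ᵇ (b≡n∸a (to T-≡ᵇ a≡ᵇk)))
  (λ b≡ᵇn∸k → from T-≡ᵇ (a≡k (to T-≡ᵇ b≡ᵇn∸k))))
  where
  b≡n∸a : a ≡ k → b ≡ n ∸ k
  b≡n∸a refl = trans (sym (ℕ.m+n∸m≡n a b)) (cong (_∸ a) a+b≡n)
  a≡k : b ≡ n ∸ k → a ≡ k
  a≡k b≡n∸k = begin
    a               ≡⟨ sym (ℕ.m+n∸n≡m a b) ⟩
    a + b ∸ b       ≡⟨ cong₂ _∸_ a+b≡n b≡n∸k ⟩
    n ∸ (n ∸ k)     ≡⟨ ℕ.m∸[m∸n]≡n k≤n ⟩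
    k               ∎

-- The shape of the counts in Defs, so that 𝔡 n k, 𝔡ᵉ n k and 𝔡ᵒ n k are
-- definitionally counts over allPADs n.
count : ∀ {A : Set} → (A → Bool) → List A → ℕ
count p xs = length (filter (λ x → T? (p x)) xs)

module _ {A : Set} where

  count-cong : ∀ {p q : A → Bool} {xs} → (∀ {x} → x ∈ xs → p x ≡ q x) → count p xs ≡ count q xs
  count-cong {xs = []} _ = refl
  count-cong {p} {q} {x ∷ xs} p≡q rewrite p≡q (here refl) with q x
  ... | true  = cong suc (count-cong (λ x∈ → p≡q (there x∈)))
  ... | false = count-cong (λ x∈ → p≡q (there x∈))

  count-map : ∀ {B : Set} (p : B → Bool) (f : A → B) xs → count p (map f xs) ≡ count (p ∘ f) xs
  count-map p f [] = refl
  count-map p f (x ∷ xs) with p (f x)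
  ... | true  = cong suc (count-map p f xs)
  ... | false = count-map p f xs

  count-complement : ∀ {p q : A → Bool} {xs} → (∀ {x} → x ∈ xs → q x ≡ not (p x)) →
                     count p xs + count q xs ≡ length xs
  count-complement {xs = []} _ = refl
  count-complement {p} {q} {x ∷ xs} q≡¬p rewrite q≡¬p (here refl) with p x
  ... | true  = cong suc (count-complement (λ x∈ → q≡¬p (there x∈)))
  ... | false = trans (ℕ.+-suc _ _) (cong suc (count-complement (λ x∈ → q≡¬p (there x∈))))

  Unique-map⁺ : ∀ {B : Set} (f : A → B) {xs} → (∀ {x y} → x ∈ xs → y ∈ xs → f x ≡ f y → x ≡ y) →
                Unique xs → Unique (map f xs)
  Unique-map⁺ f inj [] = []
  Unique-map⁺ f inj (x∉xs ∷ xs!) =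
    All-map⁺ (All.tabulate (λ y∈ fx≡fy → All.lookup x∉xs y∈ (inj (here refl) (there y∈) fx≡fy)))
    ∷ Unique-map⁺ f (λ x∈ y∈ → inj (there x∈) (there y∈)) xs!

  map-↭ : ∀ (f : A → A) {xs} → Unique xs →
          (∀ {x y} → x ∈ xs → y ∈ xs → f x ≡ f y → x ≡ y) →
          (∀ {x} → x ∈ xs → f x ∈ xs) → (∀ {y} → y ∈ xs → y ∈ map f xs) →
          map f xs ↭ xs
  map-↭ f {xs} xs! inj closed onto =
    ∼bag⇒↭ (unique∧set⇒bag (Unique-map⁺ f inj xs!) xs! (mk⇔ image⊆ onto))
    where
    image⊆ : ∀ {y} → y ∈ map f xs → y ∈ xs
    image⊆ y∈ with _ , x∈ , refl ← ∈-map⁻ f y∈ = closed x∈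

  involution-map-↭ : ∀ (f : A → A) {xs} → Unique xs →
                     (∀ {x} → x ∈ xs → f x ∈ xs) → (∀ {x} → x ∈ xs → f (f x) ≡ x) →
                     map f xs ↭ xs
  involution-map-↭ f {xs} xs! closed involutive = map-↭ f xs! injective closed onto
    where
    injective : ∀ {x y} → x ∈ xs → y ∈ xs → f x ≡ f y → x ≡ y
    injective x∈ y∈ fx≡fy = trans (sym (involutive x∈)) (trans (cong f fx≡fy) (involutive y∈))
    onto : ∀ {y} → y ∈ xs → y ∈ map f xs
    onto y∈ = subst (_∈ map f xs) (involutive y∈) (∈-map⁺ f (closed y∈))

  count-reindex : ∀ (f : A → A) {xs} → map f xs ↭ xs → (p q : A → Bool) →
                  (∀ {x} → x ∈ xs → p (f x) ≡ q x) → count p xs ≡ count q xs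
  count-reindex f {xs} f↭ p q pf≡q = begin
    count p xs          ≡⟨ ↭-length (filter-↭ (λ x → T? (p x)) (↭-sym f↭)) ⟩
    count p (map f xs)  ≡⟨ count-map p f xs ⟩
    count (p ∘ f) xs    ≡⟨ count-cong pf≡q ⟩
    count q xs          ∎

concatMap-prepend : ∀ {A : Set} {m} (xs : List A) (ys : List (Vec A m)) →
                    concatMap (λ x → map (x ∷_) ys) xs ≡ cartesianProductWith _∷_ xs ys
concatMap-prepend []       ys = refl
concatMap-prepend (x ∷ xs) ys = cong (map (x ∷_) ys ++_) (concatMap-prepend xs ys)

∈-allVecs : ∀ n {m} (v : Vec (Fin n) m) → v ∈ allVecs n m
∈-allVecs n []      = here refl
∈-allVecs n (x ∷ v) = subst (x ∷ v ∈_) (sym (concatMap-prepend (allFin n) _))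
  (∈-cartesianProductWith⁺ _∷_ (∈-allFin x) (∈-allVecs n v))

allVecs-unique : ∀ n m → Unique (allVecs n m)
allVecs-unique n zero    = [] ∷ []
allVecs-unique n (suc m) = subst Unique (sym (concatMap-prepend (allFin n) _))
  (cartesianProductWith⁺ _∷_ ∷-injective (allFin⁺ n) (allVecs-unique n m))

module _ {n} (σ : Vec (Fin n) n) where

  isPermᵇ⇔surjective : T (isPermᵇ σ) ⇔ (∀ j → ∃ λ i → lookup σ i ≡ j)
  isPermᵇ⇔surjective = mk⇔
    (λ h j → map₂ (to T-toℕ-≡ᵇ) (satisfied (any⁻ _ (allFin n) (to (T-all-allFin _) h j))))
    (λ h → from (T-all-allFin _) λ j →
      let i , σi≡j = h j in any⁺ _ (lose (∈-allFin i) (from T-toℕ-≡ᵇ σi≡j)))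

  isPAPᵇ⇔ : T (isPAPᵇ σ) ⇔ (∀ i → parity (toℕ (lookup σ i)) ≡ parity (toℕ i))
  isPAPᵇ⇔ = mk⇔
    (λ h i → to T-≡ᵇ (to (T-all-allFin _) h i))
    (λ h → from (T-all-allFin _) (λ i → from T-≡ᵇ (h i)))

  isFixedPointFreeᵇ⇔ : T (isFixedPointFreeᵇ σ) ⇔ (∀ i → lookup σ i ≢ i)
  isFixedPointFreeᵇ⇔ = mk⇔
    (λ h i → to T-not (to (T-all-allFin _) h i) ∘ from T-toℕ-≡ᵇ)
    (λ h → from (T-all-allFin _) (λ i → from T-not (h i ∘ to T-toℕ-≡ᵇ)))

  isPADᵇ⇔ : T (isPADᵇ σ) ⇔ (T (isPermᵇ σ) × T (isPAPᵇ σ) × T (isFixedPointFreeᵇ σ))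
  isPADᵇ⇔ = mk⇔
    (λ h → map₂ (to (T-∧ {isPAPᵇ σ})) (to (T-∧ {isPermᵇ σ}) h))
    (λ (perm , pap , fpf) → from T-∧ (perm , from T-∧ (pap , fpf)))

  isCycleMinᵇ⇔ : ∀ i → T (isCycleMinᵇ σ i) ⇔ (∀ j → j < n → toℕ i ≤ toℕ (iter j σ i))
  isCycleMinᵇ⇔ i = mk⇔
    (λ h j j<n → ℕ.≤ᵇ⇒≤ _ _ (to (T-all-upTo _) h j j<n))
    (λ h → from (T-all-upTo _) (λ j j<n → ℕ.≤⇒≤ᵇ (h j j<n)))

module _ {n} (v : Vec (Fin n) n) (v-injective : Injective _≡_ _≡_ (lookup v)) where

  iter-cancelˡ : ∀ a d x → iter (a + d) v x ≡ iter a v x → iter d v x ≡ x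
  iter-cancelˡ zero    d x eq = eq
  iter-cancelˡ (suc a) d x eq = iter-cancelˡ a d x (v-injective eq)

  iter-periodic : ∀ x → ∃ λ q → q < n × iter (suc q) v x ≡ x
  iter-periodic x
    with i , j , i<j , vⁱx≡vʲx ← pigeonhole (ℕ.n<1+n n) (λ k → iter (toℕ k) v x)
    with q , 1+i+q≡j ← ℕ.m≤n⇒∃[o]m+o≡n i<j
    = q , q<n , iter-cancelˡ (toℕ i) (suc q) x
                  (trans (cong (λ t → iter t v x) i+1+q≡j) (sym vⁱx≡vʲx))
    where
    i+1+q≡j : toℕ i + suc q ≡ toℕ j
    i+1+q≡j = trans (ℕ.+-suc (toℕ i) q) 1+i+q≡j
    q<n : q < n
    q<n = ℕ.m+n≤o⇒n≤o (toℕ i) (subst (_≤ n) (sym i+1+q≡j) (s≤s⁻¹ (toℕ<n j)))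

module _ {n} {σ τ : Vec (Fin n) n} (τσ≡id : ∀ x → lookup τ (lookup σ x) ≡ x) where

  iter-leftInverse : ∀ {x q} → iter (suc q) σ x ≡ x → ∀ j → ∃ λ m → m ≤ q × iter j τ x ≡ iter m σ x
  iter-leftInverse _ zero = zero , z≤n , refl
  iter-leftInverse {x} {q} σ¹⁺qx≡x (suc j) with iter-leftInverse σ¹⁺qx≡x j
  ... | suc m , m<q , τʲx≡σ¹⁺ᵐx = m , ℕ.<⇒≤ m<q , trans (cong (lookup τ) τʲx≡σ¹⁺ᵐx) (τσ≡id _)
  ... | zero  , _   , τʲx≡x     = q , ℕ.≤-refl ,
    trans (cong (lookup τ) (trans τʲx≡x (sym σ¹⁺qx≡x))) (τσ≡id _)

  isCycleMin-leftInverse : Injective _≡_ _≡_ (lookup σ) →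
                           ∀ i → T (isCycleMinᵇ σ i) → T (isCycleMinᵇ τ i)
  isCycleMin-leftInverse σ-injective i h = from (isCycleMinᵇ⇔ τ i) λ j _ →
    let q , q<n , σ¹⁺qi≡i = iter-periodic σ σ-injective i
        m , m≤q , τʲi≡σᵐi = iter-leftInverse σ¹⁺qi≡i j
    in subst (λ y → toℕ i ≤ toℕ y) (sym τʲi≡σᵐi) (to (isCycleMinᵇ⇔ σ i) h m (ℕ.≤-<-trans m≤q q<n))

preimage : ∀ {n} → Vec (Fin n) n → Fin n → Fin n
preimage σ j with any? (λ i → lookup σ i ≟ j)
... | yes (i , _) = i
... | no  _       = j

lookup-preimage : ∀ {n} (σ : Vec (Fin n) n) → (∀ j → ∃ λ i → lookup σ i ≡ j) →
                  ∀ j → lookup σ (preimage σ j) ≡ j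
lookup-preimage σ onto j with any? (λ i → lookup σ i ≟ j)
... | yes (_ , σi≡j) = σi≡j
... | no  ∄i         = ⊥-elim (∄i (onto j))

inverse : ∀ {n} → Vec (Fin n) n → Vec (Fin n) n
inverse σ = tabulate (preimage σ)

module Inverse {n} (σ : Vec (Fin n) n) (σ-isPerm : T (isPermᵇ σ)) where

  σ⁻¹ : Vec (Fin n) n
  σ⁻¹ = inverse σ

  inverseʳ : ∀ j → lookup σ (lookup σ⁻¹ j) ≡ j
  inverseʳ j = trans (cong (lookup σ) (lookup∘tabulate (preimage σ) j))
                     (lookup-preimage σ (to (isPermᵇ⇔surjective σ) σ-isPerm) j)

  inverse-injective : Injective _≡_ _≡_ (lookup σ⁻¹)
  inverse-injective {a} {b} eq = trans (sym (inverseʳ a)) (trans (cong (lookup σ) eq) (inverseʳ b))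

  -- A right inverse that is injective on a finite set is periodic, and periodicity
  -- makes it a left inverse as well.
  inverseˡ : ∀ i → lookup σ⁻¹ (lookup σ i) ≡ i
  inverseˡ i with q , _ , periodic ← iter-periodic σ⁻¹ inverse-injective i = begin
    lookup σ⁻¹ (lookup σ i)                            ≡⟨ cong (lookup σ⁻¹ ∘ lookup σ) (sym periodic) ⟩
    lookup σ⁻¹ (lookup σ (lookup σ⁻¹ (iter q σ⁻¹ i)))  ≡⟨ cong (lookup σ⁻¹) (inverseʳ _) ⟩
    lookup σ⁻¹ (iter q σ⁻¹ i)                          ≡⟨ periodic ⟩
    i                                                  ∎

  injective : Injective _≡_ _≡_ (lookup σ)
  injective {a} {b} eq = trans (sym (inverseˡ a)) (trans (cong (lookup σ⁻¹) eq) (inverseˡ b))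

  inverse-surjective : ∀ i → ∃ λ j → lookup σ⁻¹ j ≡ i
  inverse-surjective i = lookup σ i , inverseˡ i

  inverse-isPerm : T (isPermᵇ σ⁻¹)
  inverse-isPerm = from (isPermᵇ⇔surjective σ⁻¹) inverse-surjective

  inverse-involutive : inverse σ⁻¹ ≡ σ
  inverse-involutive = begin
    tabulate (preimage σ⁻¹)  ≡⟨ tabulate-cong preimage≡σ ⟩
    tabulate (lookup σ)      ≡⟨ tabulate∘lookup σ ⟩
    σ                        ∎
    where
    preimage≡σ : ∀ j → preimage σ⁻¹ j ≡ lookup σ j
    preimage≡σ j =
      inverse-injective (trans (lookup-preimage σ⁻¹ inverse-surjective j) (sym (inverseˡ j)))

  inverse-isPAP : T (isPAPᵇ σ) → T (isPAPᵇ σ⁻¹)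
  inverse-isPAP pap = from (isPAPᵇ⇔ σ⁻¹) λ j →
    trans (sym (to (isPAPᵇ⇔ σ) pap (lookup σ⁻¹ j))) (cong (parity ∘ toℕ) (inverseʳ j))

  inverse-isFixedPointFree : T (isFixedPointFreeᵇ σ) → T (isFixedPointFreeᵇ σ⁻¹)
  inverse-isFixedPointFree fpf = from (isFixedPointFreeᵇ⇔ σ⁻¹) λ j σ⁻¹j≡j →
    to (isFixedPointFreeᵇ⇔ σ) fpf j (trans (cong (lookup σ) (sym σ⁻¹j≡j)) (inverseʳ j))

  lookup-permutes-allFin : map (lookup σ) (allFin n) ↭ allFin n
  lookup-permutes-allFin = map-↭ (lookup σ) (allFin⁺ n) (λ _ _ → injective) (λ _ → ∈-allFin _)
    (λ {j} _ → subst (_∈ map (lookup σ) (allFin n)) (inverseʳ j) (∈-map⁺ (lookup σ) (∈-allFin _)))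

  -- Reindexing by j = σ(i): j is an excedance of σ⁻¹ iff σ(i) < i.
  exc-inverse : T (isFixedPointFreeᵇ σ) → exc σ⁻¹ + exc σ ≡ n
  exc-inverse fpf = begin
    exc σ⁻¹ + exc σ
      ≡⟨ cong (_+ exc σ) (count-reindex (lookup σ) lookup-permutes-allFin _ _
           (λ {i} _ → cong (λ t → toℕ (lookup σ i) <ᵇ toℕ t) (inverseˡ i))) ⟩
    count (λ i → toℕ (lookup σ i) <ᵇ toℕ i) (allFin n) + exc σ
      ≡⟨ count-complement {xs = allFin n} (λ {i} _ → <ᵇ≡not-flip (i≢σi i)) ⟩
    length (allFin n)
      ≡⟨ length-tabulate id ⟩
    n ∎
    where
    i≢σi : ∀ i → toℕ i ≢ toℕ (lookup σ i)
    i≢σi i = to (isFixedPointFreeᵇ⇔ σ) fpf i ∘ sym ∘ toℕ-injective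

  cycles-inverse : cycles σ⁻¹ ≡ cycles σ
  cycles-inverse = count-cong {xs = allFin n} λ {i} _ → T-injective (mk⇔
    (isCycleMin-leftInverse {σ = σ⁻¹} {τ = σ} inverseʳ inverse-injective i)
    (isCycleMin-leftInverse {σ = σ} {τ = σ⁻¹} inverseˡ injective i))

  isEvenᵇ-inverse : isEvenᵇ σ⁻¹ ≡ isEvenᵇ σ
  isEvenᵇ-inverse = cong (λ c → parity (n ∸ c) ≡ᵇ 0) cycles-inverse

module _ {n} (σ : Vec (Fin n) n) (σ-isPAD : T (isPADᵇ σ)) where

  isPAD⇒isPerm : T (isPermᵇ σ)
  isPAD⇒isPerm = proj₁ (to (isPADᵇ⇔ σ) σ-isPAD)

  isPAD⇒isPAP : T (isPAPᵇ σ)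
  isPAD⇒isPAP = proj₁ (proj₂ (to (isPADᵇ⇔ σ) σ-isPAD))

  isPAD⇒isFixedPointFree : T (isFixedPointFreeᵇ σ)
  isPAD⇒isFixedPointFree = proj₂ (proj₂ (to (isPADᵇ⇔ σ) σ-isPAD))

  inverse-isPAD : T (isPADᵇ (inverse σ))
  inverse-isPAD = from (isPADᵇ⇔ (inverse σ))
    (inverse-isPerm , inverse-isPAP isPAD⇒isPAP , inverse-isFixedPointFree isPAD⇒isFixedPointFree)
    where open Inverse σ isPAD⇒isPerm

∈-allPADs⇔ : ∀ {n} {σ : Vec (Fin n) n} → σ ∈ allPADs n ⇔ T (isPADᵇ σ)
∈-allPADs⇔ {n} {σ} =
  mk⇔ (proj₂ ∘ ∈-filter⁻ isPAD? {xs = allVecs n n}) (∈-filter⁺ isPAD? (∈-allVecs n σ))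
  where
  isPAD? : (τ : Vec (Fin n) n) → Dec (T (isPADᵇ τ))
  isPAD? τ = T? (isPADᵇ τ)

inverse-permutes-allPADs : ∀ n → map inverse (allPADs n) ↭ allPADs n
inverse-permutes-allPADs n = involution-map-↭ inverse
  (Unique-filter⁺ (λ σ → T? (isPADᵇ σ)) (allVecs-unique n n))
  (λ {σ} σ∈ → from ∈-allPADs⇔ (inverse-isPAD σ (to ∈-allPADs⇔ σ∈)))
  (λ {σ} σ∈ → Inverse.inverse-involutive σ (isPAD⇒isPerm σ (to ∈-allPADs⇔ σ∈)))

proposition5 : (n k : ℕ) → k ≤ n →
    (𝔡 n k ≡ 𝔡 n (n ∸ k)) × (𝔡ᵉ n k ≡ 𝔡ᵉ n (n ∸ k)) × (𝔡ᵒ n k ≡ 𝔡ᵒ n (n ∸ k))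
proposition5 n k k≤n =
    byInversion (λ σ → exc σ ≡ᵇ k) (λ σ → exc σ ≡ᵇ n ∸ k) excᵇ-inverse
  , byInversion (λ σ → (exc σ ≡ᵇ k) ∧ isEvenᵇ σ) (λ σ → (exc σ ≡ᵇ n ∸ k) ∧ isEvenᵇ σ)
      (λ σ∈ → cong₂ _∧_ (excᵇ-inverse σ∈) (isEvenᵇ-inverse σ∈))
  , byInversion (λ σ → (exc σ ≡ᵇ k) ∧ isOddᵇ σ) (λ σ → (exc σ ≡ᵇ n ∸ k) ∧ isOddᵇ σ)
      (λ σ∈ → cong₂ _∧_ (excᵇ-inverse σ∈) (cong not (isEvenᵇ-inverse σ∈)))
  where
  byInversion : (p q : Vec (Fin n) n → Bool) → (∀ {σ} → σ ∈ allPADs n → p (inverse σ) ≡ q σ) →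
                count p (allPADs n) ≡ count q (allPADs n)
  byInversion = count-reindex inverse (inverse-permutes-allPADs n)

  excᵇ-inverse : ∀ {σ} → σ ∈ allPADs n → (exc (inverse σ) ≡ᵇ k) ≡ (exc σ ≡ᵇ n ∸ k)
  excᵇ-inverse {σ} σ∈ = ≡ᵇ-complement (exc (inverse σ)) (exc σ)
    (Inverse.exc-inverse σ (isPAD⇒isPerm σ σ-isPAD) (isPAD⇒isFixedPointFree σ σ-isPAD)) k≤n
    where
    σ-isPAD : T (isPADᵇ σ)
    σ-isPAD = to ∈-allPADs⇔ σ∈

  isEvenᵇ-inverse : ∀ {σ} → σ ∈ allPADs n → isEvenᵇ (inverse σ) ≡ isEvenᵇ σ
  isEvenᵇ-inverse {σ} σ∈ = Inverse.isEvenᵇ-inverse σ (isPAD⇒isPerm σ (to ∈-allPADs⇔ σ∈))
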